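{- For integers $n,b\geq1$ and $k\geq1$, the number of $(n,b)$-$k$-omino towers is $\binom{kn-1}{n-b}$.
   Context: Fix an integer $k\ge1$. A $k$-omino block is a horizontal $k\times1$ rectangle occupying cells $(x,y),\dots,(x+k-1,y)$ of the integer grid; $y$ is its level and $\{x,\dots,x+k-1\}$ its column set. For integers $n\ge b\ge1$, an $(n,b)$-$k$-omino tower is a finite set of $n$ pairwise non-overlapping horizontal $k$-omino blocks such that: (i) exactly $b$ of them (the base) lie at level $0$, occupying a contiguous horizontal run of $bk$ cells; (ii) the other $n-b$ blocks lie at levels $\ge1$, and every such block at columns $\{x,\dots,x+k-1\}$ and level $y$ has a block at level $y-1$ in one of the $2k-1$ positions from $\{x-k+1,\dots,x\}$ to $\{x+k-1,\dots,x+2k-2\}$ (i.e. whose column set meets $\{x,\dots,x+k-1\}$). Towers are fixed polyominoes, considered up to horizontal translation. If $b>n$ there are no such towers, consistent with $\binom{kn-1}{n-b}=0$ for $n-b<0$. -}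

module Defs where

open import Data.Nat as ℕ using (ℕ; zero; suc; _+_; _*_; _∸_; _≤_)
open import Data.Nat.Combinatorics public using (_C_)
open import Data.Integer as ℤ using (ℤ; +_; ∣_∣; _-_)
open import Data.Product using (Σ; ∃; _×_; _,_; proj₁; proj₂)
open import Data.Sum using (_⊎_)
open import Data.List using (List; []; _∷_; _++_; map; length; upTo)
open import Data.List.Membership.Propositional using (_∈_)
open import Data.List.Relation.Unary.All using (All)
open import Data.List.Relation.Unary.AllPairs using (AllPairs)
open import Data.List.Relation.Unary.Linked using (Linked)
open import Data.List.Relation.Unary.Unique.Propositional using (Unique)
open import Relation.Binary.PropositionalEquality using (_≡_; _≢_)
open import Function.Bundles using (_⇔_)

-- A k-omino block is given by its leftmost column x and its level y:
-- it occupies cells (x,y), ..., (x+k-1,y).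
Block : Set
Block = ℤ × ℕ

col : Block → ℤ
col = proj₁

lev : Block → ℕ
lev = proj₂

-- Strict lexicographic order on blocks (first by level, then by column).
-- A finite set of blocks is represented canonically as a strictly
-- increasing list w.r.t. this order.
_<ᴮ_ : Block → Block → Set
p <ᴮ q = (lev p ℕ.< lev q) ⊎ ((lev p ≡ lev q) × (col p ℤ.< col q))

-- Two k-omino blocks do not overlap: different levels, or their column
-- sets {x..x+k-1}, {x'..x'+k-1} are disjoint, i.e. |x - x'| ≥ k.
NonOverlapping : ℕ → Block → Block → Set
NonOverlapping k p q = (lev p ≢ lev q) ⊎ (k ≤ ∣ col p - col q ∣)

ColumnsMeet : ℕ → Block → Block → Set
ColumnsMeet k p q = ∣ col p - col q ∣ ℕ.< k

Supported : ℕ → List Block → Block → Set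
Supported k l p = ∃ λ q → q ∈ l × (suc (lev q) ≡ lev p) × ColumnsMeet k p q

-- The base of b blocks at level 0, normalized (translation) so that it
-- occupies columns 0, ..., bk-1, i.e. blocks at columns 0, k, ..., (b-1)k.
baseRow : ℕ → ℕ → List Block
baseRow k b = map (λ i → (+ (i * k) , 0)) (upTo b)

-- An (n,b)-k-omino tower, normalized up to horizontal translation so that
-- its base starts at column 0, and represented as a strictly sorted list.
record IsTower (k n b : ℕ) (l : List Block) : Set where
  field
    sorted      : Linked _<ᴮ_ l
    size        : length l ≡ n
    nonOverlap  : AllPairs (NonOverlapping k) l
    base        : Σ (List Block) λ rest →
                    (l ≡ baseRow k b ++ rest) × All (λ p → 1 ≤ lev p) rest
    supported   : All (λ p → lev p ≡ 0 ⊎ Supported k l p) l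

-- "The number of (n,b)-k-omino towers is N": there is a duplicate-free
-- list of exactly the (canonical representatives of) towers, of length N.
NumberOfTowers : ℕ → ℕ → ℕ → ℕ → Set
NumberOfTowers k n b N =
  Σ (List (List Block)) λ L →
    Unique L × (∀ l → (l ∈ L) ⇔ IsTower k n b l) × (length L ≡ N)

binomℤ : ℕ → ℤ → ℕ
binomℤ m (+ j)      = m C j
binomℤ m ℤ.-[1+ _ ] = 0

-- Count, more generally, the extensions P of an arbitrary ground G: blocks stacked on G ∪ P
-- in which every block that rests on no lower block of P meeting it starts in a window
-- [lo, lo + N) of columns that all meet G.  Their number depends only on the size m of P and
-- the width N.  Consider the block resting on G at the first column lo.  Unless it is in P
-- and no block of P meeting it lies lower (P is "pivotal"), P is an extension for the window
-- [lo + 1, lo + N).  Otherwise removing it leaves an extension of the ground enlarged by it,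
-- for the window [lo - k + 1, max (lo + N, lo + k)).  So
--   count m N = count m (N - 1) + count (m - 1) (max (N + k - 1, 2k - 1)),
-- which Pascal's rule and absorption solve as count m (k + j) = C (j + k m, m).  A tower is an
-- extension of its base row, whose meeting columns form a window of width b k + k - 1; with
-- m = n - b this gives C (k n - 1, n - b).

module Submission where

open import Data.Integer as ℤ using (ℤ; +_; _-_)
import Data.Integer.Properties as ℤ
import Data.Integer.Tactic.RingSolver as ℤ
open import Data.List using (List; []; _∷_; _++_; map; length; upTo; filter)
open import Data.List.Properties using (length-++; length-map; length-upTo; ++-cancelˡ)
open import Data.List.Membership.Propositional using (_∈_; _∉_; find; lose)
open import Data.List.Membership.Propositional.Properties
  using (∈-map⁺; ∈-map⁻; ∈-++⁺ˡ; ∈-++⁺ʳ; ∈-++⁻; ∈-upTo⁺; ∈-upTo⁻; ∈-filter⁺; ∈-filter⁻)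
open import Data.List.Relation.Binary.Disjoint.Propositional using (Disjoint)
open import Data.List.Relation.Binary.Subset.Propositional using (_⊆_)
open import Data.List.Relation.Unary.Any using (here; there; any?)
open import Data.List.Relation.Unary.All as All using (All; []; _∷_)
import Data.List.Relation.Unary.All.Properties as All
open import Data.List.Relation.Unary.AllPairs as AllPairs using (AllPairs; []; _∷_)
import Data.List.Relation.Unary.AllPairs.Properties as AllPairs
import Data.List.Relation.Unary.Linked.Properties as Linked
open import Data.List.Relation.Unary.Unique.Propositional using (Unique)
import Data.List.Relation.Unary.Unique.Propositional.Properties as Unique
open import Data.Nat as ℕ using (ℕ; zero; suc; _+_; _*_; _∸_; _≤_; _<_; _⊔_; z≤n; s≤s)
import Data.Nat.Properties as ℕ
import Data.Nat.Tactic.RingSolver as ℕ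
open import Data.Nat.Combinatorics using (nCk+nC[k+1]≡[n+1]C[k+1]; nC1≡n; k>n⇒nCk≡0)
open import Data.Nat.DivMod using (_/_; _%_; m≡m%n+[m/n]*n; m%n<n; m<n*o⇒m/o<n)
open import Data.Product as Prod using (∃; _×_; _,_; proj₁; proj₂)
open import Data.Sum as Sum using (_⊎_; inj₁; inj₂; [_,_]′)
open import Function using (_∘_; _⇔_; mk⇔; Equivalence)
open import Level using (Level)
open import Relation.Binary.Core using (Rel)
open import Relation.Binary.Definitions using (Trichotomous; tri<; tri≈; tri>)
open import Relation.Binary.Structures using (IsStrictTotalOrder)
open import Relation.Binary.PropositionalEquality
  using (_≡_; _≢_; refl; sym; trans; cong; cong₂; subst; subst₂; resp₂; isEquivalence; module ≡-Reasoning)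
open import Relation.Nullary using (¬_; Dec; yes; no; ¬?; contradiction)
open import Relation.Nullary.Decidable as Dec using (_×-dec_; _→-dec_)

open import Defs

-- Lists

module _ {a r : Level} {A : Set a} {R : Rel A r} where

  AllPairs-++⁻ʳ : ∀ xs {ys} → AllPairs R (xs ++ ys) → AllPairs R ys
  AllPairs-++⁻ʳ []       Rys        = Rys
  AllPairs-++⁻ʳ (_ ∷ xs) (_ ∷ Rxys) = AllPairs-++⁻ʳ xs Rxys

  AllPairs-lookup : ∀ {xs x y} → AllPairs R xs → x ∈ xs → y ∈ xs → x ≢ y → R x y ⊎ R y x
  AllPairs-lookup (_   ∷ _)   (here refl) (here refl) x≢y = contradiction refl x≢y
  AllPairs-lookup (Rxs ∷ _)   (here refl) (there y∈) _    = inj₁ (All.lookup Rxs y∈)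
  AllPairs-lookup (Rxs ∷ _)   (there x∈)  (here refl) _   = inj₂ (All.lookup Rxs x∈)
  AllPairs-lookup (_   ∷ Rxs) (there x∈)  (there y∈) x≢y  = AllPairs-lookup Rxs x∈ y∈ x≢y

  AllPairs-map-∈ : ∀ {s} {S : Rel A s} {xs} → (∀ {x y} → x ∈ xs → y ∈ xs → R x y → S x y) →
                   AllPairs R xs → AllPairs S xs
  AllPairs-map-∈ {xs = []}     R⇒S []          = []
  AllPairs-map-∈ {xs = x ∷ xs} R⇒S (Rx ∷ Rxs) =
    All.tabulate (λ y∈ → R⇒S (here refl) (there y∈) (All.lookup Rx y∈)) ∷
    AllPairs-map-∈ (λ x∈ y∈ → R⇒S (there x∈) (there y∈)) Rxs

Unique-map⁺-∈ : ∀ {a b} {A : Set a} {B : Set b} {f : A → B} {xs} →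
                (∀ {x y} → x ∈ xs → y ∈ xs → f x ≡ f y → x ≡ y) → Unique xs → Unique (map f xs)
Unique-map⁺-∈ inj = AllPairs.map⁺ ∘ AllPairs-map-∈ (λ x∈ y∈ x≢y fx≡fy → x≢y (inj x∈ y∈ fx≡fy))

module StrictlySorted {a r : Level} {A : Set a} {_<_ : Rel A r}
                      (sto : IsStrictTotalOrder _≡_ _<_) where

  open IsStrictTotalOrder sto using (compare; _<?_; _≟_) renaming (trans to <-trans; irrefl to <-irrefl)

  Sorted : List A → Set _
  Sorted = AllPairs _<_

  insert : A → List A → List A
  insert a []       = a ∷ []
  insert a (x ∷ xs) with x <? a
  ... | yes _ = x ∷ insert a xs
  ... | no  _ = a ∷ x ∷ xs

  ∈-insert⁺ˡ : ∀ a xs → a ∈ insert a xs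
  ∈-insert⁺ˡ a []       = here refl
  ∈-insert⁺ˡ a (x ∷ xs) with x <? a
  ... | yes _ = there (∈-insert⁺ˡ a xs)
  ... | no  _ = here refl

  ∈-insert⁺ʳ : ∀ {y} a xs → y ∈ xs → y ∈ insert a xs
  ∈-insert⁺ʳ a (x ∷ xs) y∈ with x <? a | y∈
  ... | yes _ | here y≡x   = here y≡x
  ... | yes _ | there y∈xs = there (∈-insert⁺ʳ a xs y∈xs)
  ... | no  _ | _          = there y∈

  ∈-insert⁻ : ∀ {y} a xs → y ∈ insert a xs → y ≡ a ⊎ y ∈ xs
  ∈-insert⁻ a []       (here y≡a) = inj₁ y≡a
  ∈-insert⁻ a (x ∷ xs) y∈ with x <? a | y∈
  ... | yes _ | here y≡x  = inj₂ (here y≡x)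
  ... | yes _ | there y∈′ = Sum.map₂ there (∈-insert⁻ a xs y∈′)
  ... | no  _ | here y≡a  = inj₁ y≡a
  ... | no  _ | there y∈′ = inj₂ y∈′

  length-insert : ∀ a xs → length (insert a xs) ≡ suc (length xs)
  length-insert a []       = refl
  length-insert a (x ∷ xs) with x <? a
  ... | yes _ = cong suc (length-insert a xs)
  ... | no  _ = refl

  private
    ≮∧≢⇒> : ∀ {a x} → ¬ (x < a) → a ≢ x → a < x
    ≮∧≢⇒> {a} {x} x≮a a≢x with compare a x
    ... | tri< a<x _ _ = a<x
    ... | tri≈ _ a≡x _ = contradiction a≡x a≢x
    ... | tri> _ _ x<a = contradiction x<a x≮a

  insert⁺ : ∀ {a xs} → a ∉ xs → Sorted xs → Sorted (insert a xs)
  insert⁺ {a} {[]}     _  []           = [] ∷ []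
  insert⁺ {a} {x ∷ xs} a∉ (x<xs ∷ xs↑) with x <? a
  ... | yes x<a = All.tabulate x<insert ∷ insert⁺ (a∉ ∘ there) xs↑
    where
    x<insert : ∀ {y} → y ∈ insert a xs → x < y
    x<insert y∈ = [ (λ { refl → x<a }) , All.lookup x<xs ]′ (∈-insert⁻ a xs y∈)
  ... | no x≮a = (a<x ∷ All.map (<-trans a<x) x<xs) ∷ x<xs ∷ xs↑
    where
    a<x : a < x
    a<x = ≮∧≢⇒> x≮a (a∉ ∘ here)

  sorted-≡ : ∀ {xs ys} → Sorted xs → Sorted ys → xs ⊆ ys → ys ⊆ xs → xs ≡ ys
  sorted-≡ [] [] _ _ = refl
  sorted-≡ [] (_ ∷ _) _ ys⊆ with () ← ys⊆ (here refl)
  sorted-≡ (_ ∷ _) [] xs⊆ _ with () ← xs⊆ (here refl)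
  sorted-≡ {x ∷ xs} {y ∷ ys} (x<xs ∷ xs↑) (y<ys ∷ ys↑) xs⊆ ys⊆ =
    cong₂ _∷_ x≡y (sorted-≡ xs↑ ys↑ tail⊆ tail⊇)
    where
    x≡y : x ≡ y
    x≡y with xs⊆ (here refl) | ys⊆ (here refl)
    ... | here x≡y   | _          = x≡y
    ... | there _    | here y≡x   = sym y≡x
    ... | there x∈ys | there y∈xs =
      contradiction (<-trans (All.lookup y<ys x∈ys) (All.lookup x<xs y∈xs)) (<-irrefl refl)
    tail⊆ : xs ⊆ ys
    tail⊆ z∈ with xs⊆ (there z∈)
    ... | here z≡y   = contradiction (All.lookup x<xs z∈) (<-irrefl (trans x≡y (sym z≡y)))
    ... | there z∈ys = z∈ys
    tail⊇ : ys ⊆ xs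
    tail⊇ z∈ with ys⊆ (there z∈)
    ... | here z≡x   = contradiction (All.lookup y<ys z∈) (<-irrefl (trans (sym x≡y) (sym z≡x)))
    ... | there z∈xs = z∈xs

  remove : A → List A → List A
  remove a = filter (λ x → ¬? (x ≟ a))

  ∈-remove⁻ : ∀ {y} a xs → y ∈ remove a xs → y ∈ xs × y ≢ a
  ∈-remove⁻ a xs = ∈-filter⁻ (λ x → ¬? (x ≟ a))

  ∈-remove⁺ : ∀ {y} a xs → y ∈ xs → y ≢ a → y ∈ remove a xs
  ∈-remove⁺ a xs = ∈-filter⁺ (λ x → ¬? (x ≟ a))

  remove⁺ : ∀ a {xs} → Sorted xs → Sorted (remove a xs)
  remove⁺ a = AllPairs.filter⁺ (λ x → ¬? (x ≟ a))

  insert-remove : ∀ {a xs} → Sorted xs → a ∈ xs → insert a (remove a xs) ≡ xs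
  insert-remove {a} {xs} xs↑ a∈ =
    sorted-≡ (insert⁺ (λ a∈′ → proj₂ (∈-remove⁻ a xs a∈′) refl) (remove⁺ a xs↑)) xs↑ ⊆xs xs⊆
    where
    ⊆xs : insert a (remove a xs) ⊆ xs
    ⊆xs y∈ = [ (λ { refl → a∈ }) , proj₁ ∘ ∈-remove⁻ a xs ]′ (∈-insert⁻ a (remove a xs) y∈)
    xs⊆ : xs ⊆ insert a (remove a xs)
    xs⊆ {y} y∈ with y ≟ a
    ... | yes refl = ∈-insert⁺ˡ a (remove a xs)
    ... | no  y≢a  = ∈-insert⁺ʳ a (remove a xs) (∈-remove⁺ a xs y∈ y≢a)

  insert-injective : ∀ {a xs ys} → a ∉ xs → a ∉ ys → Sorted xs → Sorted ys →
                     insert a xs ≡ insert a ys → xs ≡ ys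
  insert-injective {a} a∉xs a∉ys xs↑ ys↑ eq = sorted-≡ xs↑ ys↑ (transport a∉xs eq) (transport a∉ys (sym eq))
    where
    transport : ∀ {us vs} → a ∉ us → insert a us ≡ insert a vs → us ⊆ vs
    transport {us} {vs} a∉us eq z∈ with ∈-insert⁻ a vs (subst (_ ∈_) eq (∈-insert⁺ʳ a us z∈))
    ... | inj₁ refl = contradiction z∈ a∉us
    ... | inj₂ z∈vs = z∈vs

-- Blocks

<ᴮ-irrefl : ∀ {p q} → p ≡ q → ¬ (p <ᴮ q)
<ᴮ-irrefl refl (inj₁ y<y)       = ℕ.<-irrefl refl y<y
<ᴮ-irrefl refl (inj₂ (_ , x<x)) = ℤ.<-irrefl refl x<x

<ᴮ-trans : ∀ {p q r} → p <ᴮ q → q <ᴮ r → p <ᴮ r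
<ᴮ-trans (inj₁ y<y′)          (inj₁ y′<y″)          = inj₁ (ℕ.<-trans y<y′ y′<y″)
<ᴮ-trans (inj₁ y<y′)          (inj₂ (refl , _))     = inj₁ y<y′
<ᴮ-trans (inj₂ (refl , _))    (inj₁ y<y″)           = inj₁ y<y″
<ᴮ-trans (inj₂ (refl , x<x′)) (inj₂ (refl , x′<x″)) = inj₂ (refl , ℤ.<-trans x<x′ x′<x″)

<ᴮ-connected : ∀ p q → p <ᴮ q ⊎ p ≡ q ⊎ q <ᴮ p
<ᴮ-connected (x , y) (x′ , y′) with ℕ.<-cmp y y′ | ℤ.<-cmp x x′
... | tri< y<y′ _ _ | _             = inj₁ (inj₁ y<y′)
... | tri> _ _ y′<y | _             = inj₂ (inj₂ (inj₁ y′<y))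
... | tri≈ _ refl _ | tri< x<x′ _ _ = inj₁ (inj₂ (refl , x<x′))
... | tri≈ _ refl _ | tri≈ _ refl _ = inj₂ (inj₁ refl)
... | tri≈ _ refl _ | tri> _ _ x′<x = inj₂ (inj₂ (inj₂ (refl , x′<x)))

<ᴮ-asym : ∀ {p q} → p <ᴮ q → ¬ (q <ᴮ p)
<ᴮ-asym p<q q<p = <ᴮ-irrefl refl (<ᴮ-trans p<q q<p)

<ᴮ-compare : Trichotomous _≡_ _<ᴮ_
<ᴮ-compare p q with <ᴮ-connected p q
... | inj₁ p<q        = tri< p<q (λ p≡q → <ᴮ-irrefl p≡q p<q) (<ᴮ-asym p<q)
... | inj₂ (inj₁ p≡q) = tri≈ (<ᴮ-irrefl p≡q) p≡q (<ᴮ-irrefl (sym p≡q))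
... | inj₂ (inj₂ q<p) = tri> (<ᴮ-asym q<p) (λ p≡q → <ᴮ-irrefl (sym p≡q) q<p) q<p

<ᴮ-isStrictTotalOrder : IsStrictTotalOrder _≡_ _<ᴮ_
<ᴮ-isStrictTotalOrder = record
  { isStrictPartialOrder = record
    { isEquivalence = isEquivalence
    ; irrefl        = <ᴮ-irrefl
    ; trans         = <ᴮ-trans
    ; <-resp-≈      = resp₂ _<ᴮ_
    }
  ; compare = <ᴮ-compare
  }

open StrictlySorted <ᴮ-isStrictTotalOrder

_≟ᴮ_ : (p q : Block) → Dec (p ≡ q)
_≟ᴮ_ = IsStrictTotalOrder._≟_ <ᴮ-isStrictTotalOrder

open import Data.List.Membership.DecPropositional _≟ᴮ_ using (_∈?_)

<ᴮ⇒lev≤ : ∀ {p q} → p <ᴮ q → lev p ≤ lev q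
<ᴮ⇒lev≤ (inj₁ y<y′)       = ℕ.<⇒≤ y<y′
<ᴮ⇒lev≤ (inj₂ (y≡y′ , _)) = ℕ.≤-reflexive y≡y′

-- Columns and windows

i<i+suc : ∀ i n → i ℤ.< i ℤ.+ + suc n
i<i+suc i n = subst (ℤ._< i ℤ.+ + suc n) (ℤ.+-identityʳ i) (ℤ.+-monoʳ-< i (ℤ.+<+ (s≤s z≤n)))

∣-∣<⇔ : ∀ {x y n} → x ℤ.≤ y → (ℤ.∣ x - y ∣ < n ⇔ y ℤ.< x ℤ.+ + n)
∣-∣<⇔ {x} {y} {n} x≤y = mk⇔ to from
  where
  add-sub : ∀ a b → a ℤ.+ b - a ≡ b
  add-sub = ℤ.solve-∀
  sub-add : ∀ a b → b - a ℤ.+ a ≡ b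
  sub-add = ℤ.solve-∀
  to : ℤ.∣ x - y ∣ < n → y ℤ.< x ℤ.+ + n
  to d<n = subst₂ ℤ._<_ (sub-add x y) (ℤ.+-comm (+ n) x)
             (ℤ.+-monoˡ-< x (subst (ℤ._< + n) (ℤ.∣-∣-≤ x≤y) (ℤ.+<+ d<n)))
  from : y ℤ.< x ℤ.+ + n → ℤ.∣ x - y ∣ < n
  from y<x+n = ℤ.drop‿+<+ (subst₂ ℤ._<_ (sym (ℤ.∣-∣-≤ x≤y)) (add-sub x (+ n))
                 (ℤ.+-monoˡ-< (ℤ.- x) y<x+n))

Within : ℤ → ℕ → ℤ → Set
Within lo N c = lo ℤ.≤ c × c ℤ.< lo ℤ.+ + N

private
  suc-+ : ∀ lo n → (ℤ.1ℤ ℤ.+ lo) ℤ.+ n ≡ lo ℤ.+ (ℤ.1ℤ ℤ.+ n)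
  suc-+ = ℤ.solve-∀

within-tail : ∀ {lo N c} → Within (ℤ.suc lo) N c → Within lo (suc N) c
within-tail {lo} {N} (lo<c , c<end) =
  ℤ.<⇒≤ (ℤ.suc[i]≤j⇒i<j lo<c) , subst (_ ℤ.<_) (suc-+ lo (+ N)) c<end

within-head⊎tail : ∀ {lo N c} → Within lo (suc N) c → c ≡ lo ⊎ Within (ℤ.suc lo) N c
within-head⊎tail {lo} {N} {c} (lo≤c , c<end) with ℤ.<-cmp lo c
... | tri< lo<c _ _ = inj₂ (ℤ.i<j⇒suc[i]≤j lo<c , subst (_ ℤ.<_) (sym (suc-+ lo (+ N))) c<end)
... | tri≈ _ lo≡c _ = inj₁ (sym lo≡c)
... | tri> _ _ c<lo = contradiction lo≤c (ℤ.<⇒≱ c<lo)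

within-zero : ∀ {lo c} → ¬ Within lo 0 c
within-zero {lo} (lo≤c , c<lo+0) = ℤ.<⇒≱ (subst (_ ℤ.<_) (ℤ.+-identityʳ lo) c<lo+0) lo≤c

head-within : ∀ {lo N} → Within lo (suc N) lo
head-within {lo} {N} = ℤ.≤-refl , i<i+suc lo N

head∉tail : ∀ {lo N} → ¬ Within (ℤ.suc lo) N lo
head∉tail (suc-lo≤lo , _) = ℤ.<-irrefl refl (ℤ.suc[i]≤j⇒i<j suc-lo≤lo)

module Columns (k₀ : ℕ) where

  open Equivalence using (to; from)

  k : ℕ
  k = suc k₀

  Meets : ℤ → ℤ → Set
  Meets x y = x ℤ.< y ℤ.+ + k × y ℤ.< x ℤ.+ + k

  meets-sym : ∀ {x y} → Meets x y → Meets y x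
  meets-sym (x<y+k , y<x+k) = y<x+k , x<y+k

  meets-refl : ∀ {x} → Meets x x
  meets-refl {x} = i<i+suc x k₀ , i<i+suc x k₀

  meets? : ∀ x y → Dec (Meets x y)
  meets? x y = (x ℤ.<? y ℤ.+ + k) ×-dec (y ℤ.<? x ℤ.+ + k)

  columnsMeet⇔meets : ∀ {x y} → ℤ.∣ x - y ∣ < k ⇔ Meets x y
  columnsMeet⇔meets {x} {y} with ℤ.≤-total x y
  ... | inj₁ x≤y = mk⇔ (λ close → ℤ.≤-<-trans x≤y (i<i+suc y k₀) , to (∣-∣<⇔ x≤y) close)
                        (from (∣-∣<⇔ x≤y) ∘ proj₂)
  ... | inj₂ y≤x = mk⇔ (λ close → to (∣-∣<⇔ y≤x) (flip x y close) , ℤ.≤-<-trans y≤x (i<i+suc x k₀))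
                        (flip y x ∘ from (∣-∣<⇔ y≤x) ∘ proj₁)
    where
    flip : ∀ u v → ℤ.∣ u - v ∣ < k → ℤ.∣ v - u ∣ < k
    flip u v = subst (_< k) (ℤ.∣i-j∣≡∣j-i∣ u v)

  -- When the block at column lo joins the ground, the window [lo, lo + 1 + N) becomes
  -- [lo - k₀, max (lo + 1 + N, lo + k)): its other columns together with those meeting lo.
  grow : ℕ → ℕ
  grow N = (N + k) ⊔ (k + k₀)

  grownStart : ℤ → ℤ
  grownStart lo = lo - + k₀

  grownEnd : ℤ → ℕ → ℤ
  grownEnd lo N = grownStart lo ℤ.+ + grow N

  private
    sub-suc : ∀ lo j → (ℤ.1ℤ ℤ.+ lo) - (ℤ.1ℤ ℤ.+ j) ≡ lo - j
    sub-suc = ℤ.solve-∀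
    add-sub : ∀ c j → c ℤ.+ j - j ≡ c
    add-sub = ℤ.solve-∀
    sub-add : ∀ lo j → lo - j ℤ.+ j ≡ lo
    sub-add = ℤ.solve-∀
    shift-end : ∀ lo j n → lo - j ℤ.+ (n ℤ.+ (ℤ.1ℤ ℤ.+ j)) ≡ lo ℤ.+ (ℤ.1ℤ ℤ.+ n)
    shift-end = ℤ.solve-∀
    shift-k : ∀ lo j → lo - j ℤ.+ ((ℤ.1ℤ ℤ.+ j) ℤ.+ j) ≡ lo ℤ.+ (ℤ.1ℤ ℤ.+ j)
    shift-k = ℤ.solve-∀

  grownEnd-cases : ∀ lo N → grownEnd lo N ≡ lo ℤ.+ + suc N ⊎ grownEnd lo N ≡ lo ℤ.+ + k
  grownEnd-cases lo N =
    Sum.map (λ e → trans (cong (λ w → lo - + k₀ ℤ.+ + w) e) (shift-end lo (+ k₀) (+ N)))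
            (λ e → trans (cong (λ w → lo - + k₀ ℤ.+ + w) e) (shift-k lo (+ k₀)))
            (ℕ.⊔-sel (N + k) (k + k₀))

  end≤grownEnd : ∀ lo N → lo ℤ.+ + suc N ℤ.≤ grownEnd lo N
  end≤grownEnd lo N = subst (ℤ._≤ grownEnd lo N) (shift-end lo (+ k₀) (+ N))
                        (ℤ.+-monoʳ-≤ (lo - + k₀) (ℤ.+≤+ (ℕ.m≤m⊔n (N + k) (k + k₀))))

  lo+k≤grownEnd : ∀ lo N → lo ℤ.+ + k ℤ.≤ grownEnd lo N
  lo+k≤grownEnd lo N = subst (ℤ._≤ grownEnd lo N) (shift-k lo (+ k₀))
                         (ℤ.+-monoʳ-≤ (lo - + k₀) (ℤ.+≤+ (ℕ.m≤n⊔m (N + k) (k + k₀))))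

  meets-lowerBound : ∀ {c lo} → lo ℤ.< c ℤ.+ + k → grownStart lo ℤ.≤ c
  meets-lowerBound {c} {lo} lo<c+k =
    subst₂ ℤ._≤_ (sub-suc lo (+ k₀)) (add-sub c (+ k))
      (ℤ.+-monoˡ-≤ (ℤ.- + k) (ℤ.i<j⇒suc[i]≤j lo<c+k))

  meets⇒within-grown : ∀ {c lo} N → Meets c lo → Within (grownStart lo) (grow N) c
  meets⇒within-grown {c} {lo} N (c<lo+k , lo<c+k) =
    meets-lowerBound lo<c+k , ℤ.<-≤-trans c<lo+k (lo+k≤grownEnd lo N)

  within⇒within-grown : ∀ {c lo N} → Within lo (suc N) c → Within (grownStart lo) (grow N) c
  within⇒within-grown {c} {lo} {N} (lo≤c , c<end) =
    ℤ.≤-trans (ℤ.i-j≤i lo (+ k₀)) lo≤c , ℤ.<-≤-trans c<end (end≤grownEnd lo N)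

  within-grown⁻ : ∀ {c lo} N → Within (grownStart lo) (grow N) c → Meets c lo ⊎ Within lo (suc N) c
  within-grown⁻ {c} {lo} N (lo-k₀≤c , c<grown-end) with ℤ.<-cmp c lo
  ... | tri< c<lo _ _ =
    inj₁ (ℤ.<-trans c<lo (i<i+suc lo k₀) , ℤ.≤-<-trans lo≤c+k₀ (ℤ.+-monoʳ-< c (ℤ.+<+ (ℕ.n<1+n k₀))))
    where
    lo≤c+k₀ : lo ℤ.≤ c ℤ.+ + k₀
    lo≤c+k₀ = subst (ℤ._≤ c ℤ.+ + k₀) (sub-add lo (+ k₀)) (ℤ.+-monoˡ-≤ (+ k₀) lo-k₀≤c)
  ... | tri≈ _ refl _ = inj₂ head-within
  ... | tri> _ _ lo<c with c ℤ.<? lo ℤ.+ + suc N | grownEnd-cases lo N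
  ...   | yes c<end | _      = inj₂ (ℤ.<⇒≤ lo<c , c<end)
  ...   | no  c≮end | inj₁ e = contradiction (subst (c ℤ.<_) e c<grown-end) c≮end
  ...   | no  _     | inj₂ e = inj₁ (subst (c ℤ.<_) e c<grown-end , ℤ.<-trans lo<c (i<i+suc c k₀))


-- Extensions of a ground

module Extensions (k₀ : ℕ) where

  open Columns k₀

  Meetsᴮ : Block → Block → Set
  Meetsᴮ p q = Meets (col p) (col q)

  SupportedBy : List Block → Block → Set
  SupportedBy S p = ∃ λ q → q ∈ S × Meetsᴮ p q × suc (lev q) ≡ lev p

  HasLowerIn : List Block → Block → Set
  HasLowerIn S p = ∃ λ q → q ∈ S × Meetsᴮ p q × lev q < lev p

  hasLowerIn? : ∀ S p → Dec (HasLowerIn S p)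
  hasLowerIn? S p = Dec.map′ find (λ (_ , q∈ , below) → lose q∈ below)
                      (any? (λ q → meets? (col p) (col q) ×-dec (lev q ℕ.<? lev p)) S)

  record Extension (G : List Block) (lo : ℤ) (N : ℕ) (P : List Block) : Set where
    field
      sorted    : Sorted P
      disjoint  : ∀ {p q} → p ∈ P → q ∈ P → lev p ≡ lev q → Meetsᴮ p q → p ≡ q
      above     : ∀ {p g} → p ∈ P → g ∈ G → Meetsᴮ p g → lev g < lev p
      supported : ∀ {p} → p ∈ P → SupportedBy G p ⊎ SupportedBy P p
      rooted    : ∀ {p} → p ∈ P → HasLowerIn P p ⊎ Within lo N (col p)

  open Extension

  Covers : List Block → ℤ → ℕ → Set
  Covers G lo N = ∀ c → Within lo N c → ∃ λ g → g ∈ G × Meets c (col g)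

  groundHeight : List Block → ℤ → ℕ
  groundHeight []      z = 0
  groundHeight (g ∷ G) z with meets? z (col g)
  ... | yes _ = suc (lev g) ⊔ groundHeight G z
  ... | no  _ = groundHeight G z

  restingBlock : List Block → ℤ → Block
  restingBlock G z = z , groundHeight G z

  lev<groundHeight : ∀ G z {g} → g ∈ G → Meets z (col g) → lev g < groundHeight G z
  lev<groundHeight (g ∷ G) z g∈ z⋈g with meets? z (col g) | g∈
  ... | yes _   | here refl = ℕ.m≤m⊔n (suc (lev g)) (groundHeight G z)
  ... | yes _   | there g∈′ = ℕ.m≤n⇒m≤o⊔n (suc (lev g)) (lev<groundHeight G z g∈′ z⋈g)
  ... | no z⋈̸g | here refl = contradiction z⋈g z⋈̸g
  ... | no _    | there g∈′ = lev<groundHeight G z g∈′ z⋈g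

  groundHeight-least : ∀ G z {y} → (∀ {g} → g ∈ G → Meets z (col g) → lev g < y) →
                       groundHeight G z ≤ y
  groundHeight-least []      z below = z≤n
  groundHeight-least (g ∷ G) z below with meets? z (col g)
  ... | yes z⋈g = ℕ.⊔-lub (below (here refl) z⋈g) (groundHeight-least G z (below ∘ there))
  ... | no  _   = groundHeight-least G z (below ∘ there)

  groundHeight-attained : ∀ G z → groundHeight G z ≡ 0 ⊎ SupportedBy G (restingBlock G z)
  groundHeight-attained []      z = inj₁ refl
  groundHeight-attained (g ∷ G) z with meets? z (col g) | groundHeight-attained G z
  ... | no  _   | inj₁ h≡0 = inj₁ h≡0
  ... | no  _   | inj₂ (q , q∈ , z⋈q , e) = inj₂ (q , there q∈ , z⋈q , e)
  ... | yes z⋈g | inj₁ h≡0 =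
    inj₂ (g , here refl , z⋈g , sym (trans (cong (suc (lev g) ⊔_) h≡0) (ℕ.⊔-identityʳ _)))
  ... | yes z⋈g | inj₂ (q , q∈ , z⋈q , e) with ℕ.⊔-sel (suc (lev g)) (groundHeight G z)
  ...   | inj₁ e′ = inj₂ (g , here refl , z⋈g , sym e′)
  ...   | inj₂ e′ = inj₂ (q , there q∈ , z⋈q , trans e (sym e′))

  resting-supported : ∀ G z → (∃ λ g → g ∈ G × Meets z (col g)) → SupportedBy G (restingBlock G z)
  resting-supported G z (g , g∈ , z⋈g) with groundHeight-attained G z
  ... | inj₁ h≡0     = contradiction (subst (lev g <_) h≡0 (lev<groundHeight G z g∈ z⋈g)) λ ()
  ... | inj₂ support = support

  supported⇒resting : ∀ G {p} → (∀ {g} → g ∈ G → Meetsᴮ p g → lev g < lev p) → SupportedBy G p →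
                      lev p ≡ groundHeight G (col p)
  supported⇒resting G {p} below (g , g∈ , p⋈g , e) =
    ℕ.≤-antisym (subst (_≤ groundHeight G (col p)) e (lev<groundHeight G (col p) g∈ p⋈g))
                (groundHeight-least G (col p) below)

  Pivotal : List Block → ℤ → List Block → Set
  Pivotal G lo P = restingBlock G lo ∈ P × All (λ q → Meets lo (col q) → groundHeight G lo ≤ lev q) P

  pivotal? : ∀ G lo P → Dec (Pivotal G lo P)
  pivotal? G lo P = (restingBlock G lo ∈? P) ×-dec
                    All.all? (λ q → meets? lo (col q) →-dec (groundHeight G lo ℕ.≤? lev q)) P

  []-extension : ∀ {G lo N} → Extension G lo N []
  []-extension = record { sorted = [] ; disjoint = λ () ; above = λ () ; supported = λ () ; rooted = λ () }

  extension-zero : ∀ {G lo P} → Extension G lo 0 P → P ≡ []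
  extension-zero {P = []}    E = refl
  extension-zero {P = p ∷ P} E with rooted E (here refl) | sorted E
  ... | inj₁ (q , here refl , _ , q<q) | _       = contradiction q<q (ℕ.<-irrefl refl)
  ... | inj₁ (q , there q∈ , _ , q<p) | p<P ∷ _ = contradiction q<p (ℕ.≤⇒≯ (<ᴮ⇒lev≤ (All.lookup p<P q∈)))
  ... | inj₂ p-within                  | _       = contradiction p-within within-zero

  ground∉extension : ∀ {g G lo N P} → Extension (g ∷ G) lo N P → g ∉ P
  ground∉extension E g∈ = ℕ.<-irrefl refl (above E g∈ (here refl) meets-refl)

  minimal⇒pivotal : ∀ {G lo N P p} → Extension G lo N P → p ∈ P → ¬ HasLowerIn P p → Pivotal G (col p) P
  minimal⇒pivotal {G} {P = P} {p} E p∈ ¬lower =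
    subst (_∈ P) (cong (col p ,_) p-rests) p∈ ,
    All.tabulate λ {q} q∈ p⋈q → subst (_≤ lev q) p-rests (ℕ.≮⇒≥ λ q<p → ¬lower (q , q∈ , p⋈q , q<p))
    where
    p-rests : lev p ≡ groundHeight G (col p)
    p-rests with supported E p∈
    ... | inj₁ byGround           = supported⇒resting G (above E p∈) byGround
    ... | inj₂ (q , q∈ , p⋈q , e) = contradiction (q , q∈ , p⋈q , ℕ.≤-reflexive e) ¬lower

  extension-tail-¬pivotal : ∀ {G lo N P} → Extension G (ℤ.suc lo) N P → ¬ Pivotal G lo P
  extension-tail-¬pivotal E (A∈ , A≤P) with rooted E A∈
  ... | inj₁ (q , q∈ , A⋈q , q<A) = ℕ.<⇒≱ q<A (All.lookup A≤P q∈ A⋈q)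
  ... | inj₂ A-within            = head∉tail A-within

  extension-widen : ∀ {G lo N P} → Extension G (ℤ.suc lo) N P → Extension G lo (suc N) P
  extension-widen E = record
    { sorted = sorted E ; disjoint = disjoint E ; above = above E ; supported = supported E
    ; rooted = Sum.map₂ within-tail ∘ rooted E
    }

  extension-narrow : ∀ {G lo N P} → Extension G lo (suc N) P → ¬ Pivotal G lo P →
                     Extension G (ℤ.suc lo) N P
  extension-narrow {G} {lo} {N} {P} E ¬pivotal = record
    { sorted = sorted E ; disjoint = disjoint E ; above = above E ; supported = supported E
    ; rooted = rooted′
    }
    where
    rooted′ : ∀ {p} → p ∈ P → HasLowerIn P p ⊎ Within (ℤ.suc lo) N (col p)
    rooted′ {p} p∈ with rooted E p∈
    ... | inj₁ lower = inj₁ lower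
    ... | inj₂ p-within with within-head⊎tail p-within
    ...   | inj₂ p-within′ = inj₂ p-within′
    ...   | inj₁ p-at-lo with hasLowerIn? P p
    ...     | yes lower = inj₁ lower
    ...     | no ¬lower =
      contradiction (subst (λ z → Pivotal G z P) p-at-lo (minimal⇒pivotal E p∈ ¬lower)) ¬pivotal

  module _ {G lo N P} (E : Extension (restingBlock G lo ∷ G) (grownStart lo) (grow N) P) where

    private
      A = restingBlock G lo

      A<P : ∀ {p} → p ∈ P → Meetsᴮ p A → lev A < lev p
      A<P p∈ = above E p∈ (here refl)

    extension-insert : Covers G lo (suc N) → Extension G lo (suc N) (insert A P)
    extension-insert covers = record
      { sorted = insert⁺ (ground∉extension E) (sorted E) ; disjoint = disjoint′ ; above = above′
      ; supported = supported′ ; rooted = rooted′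
      }
      where
      disjoint′ : ∀ {p q} → p ∈ insert A P → q ∈ insert A P → lev p ≡ lev q → Meetsᴮ p q → p ≡ q
      disjoint′ p∈ q∈ p~q p⋈q with ∈-insert⁻ A P p∈ | ∈-insert⁻ A P q∈
      ... | inj₁ refl | inj₁ refl = refl
      ... | inj₁ refl | inj₂ q∈P  = contradiction (A<P q∈P (meets-sym p⋈q)) (ℕ.<-irrefl p~q)
      ... | inj₂ p∈P  | inj₁ refl = contradiction (A<P p∈P p⋈q) (ℕ.<-irrefl (sym p~q))
      ... | inj₂ p∈P  | inj₂ q∈P  = disjoint E p∈P q∈P p~q p⋈q
      above′ : ∀ {p g} → p ∈ insert A P → g ∈ G → Meetsᴮ p g → lev g < lev p
      above′ p∈ g∈ p⋈g with ∈-insert⁻ A P p∈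
      ... | inj₁ refl = lev<groundHeight G lo g∈ p⋈g
      ... | inj₂ p∈P  = above E p∈P (there g∈) p⋈g
      supported′ : ∀ {p} → p ∈ insert A P → SupportedBy G p ⊎ SupportedBy (insert A P) p
      supported′ p∈ with ∈-insert⁻ A P p∈
      ... | inj₁ refl = inj₁ (resting-supported G lo (covers lo head-within))
      ... | inj₂ p∈P with supported E p∈P
      ...   | inj₁ (g , here refl , p⋈g , e) = inj₂ (g , ∈-insert⁺ˡ A P , p⋈g , e)
      ...   | inj₁ (g , there g∈ , p⋈g , e) = inj₁ (g , g∈ , p⋈g , e)
      ...   | inj₂ (q , q∈ , p⋈q , e)       = inj₂ (q , ∈-insert⁺ʳ A P q∈ , p⋈q , e)
      rooted′ : ∀ {p} → p ∈ insert A P → HasLowerIn (insert A P) p ⊎ Within lo (suc N) (col p)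
      rooted′ p∈ with ∈-insert⁻ A P p∈
      ... | inj₁ refl = inj₂ head-within
      ... | inj₂ p∈P with rooted E p∈P
      ...   | inj₁ (q , q∈ , p⋈q , q<p) = inj₁ (q , ∈-insert⁺ʳ A P q∈ , p⋈q , q<p)
      ...   | inj₂ p-within with within-grown⁻ N p-within
      ...     | inj₁ p⋈A       = inj₁ (A , ∈-insert⁺ˡ A P , p⋈A , A<P p∈P p⋈A)
      ...     | inj₂ p-within′ = inj₂ p-within′

    insert-pivotal : Pivotal G lo (insert A P)
    insert-pivotal = ∈-insert⁺ˡ A P , All.tabulate A≤
      where
      A≤ : ∀ {q} → q ∈ insert A P → Meets lo (col q) → groundHeight G lo ≤ lev q
      A≤ q∈ lo⋈q with ∈-insert⁻ A P q∈
      ... | inj₁ refl = ℕ.≤-refl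
      ... | inj₂ q∈P  = ℕ.<⇒≤ (A<P q∈P (meets-sym lo⋈q))

  extension-remove : ∀ {G lo N P} → Extension G lo (suc N) P → Pivotal G lo P →
                     Extension (restingBlock G lo ∷ G) (grownStart lo) (grow N) (remove (restingBlock G lo) P)
  extension-remove {G} {lo} {N} {P} E (A∈ , A≤P) = record
    { sorted = remove⁺ A (sorted E) ; disjoint = disjoint′ ; above = above′
    ; supported = supported′ ; rooted = rooted′
    }
    where
    A = restingBlock G lo
    P′ = remove A P
    disjoint′ : ∀ {p q} → p ∈ P′ → q ∈ P′ → lev p ≡ lev q → Meetsᴮ p q → p ≡ q
    disjoint′ p∈ q∈ = disjoint E (proj₁ (∈-remove⁻ A P p∈)) (proj₁ (∈-remove⁻ A P q∈))
    A<P : ∀ {p} → p ∈ P → p ≢ A → Meetsᴮ p A → lev A < lev p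
    A<P {p} p∈ p≢A p⋈A with ℕ.<-cmp (lev p) (lev A)
    ... | tri< p<A _ _ = contradiction (All.lookup A≤P p∈ (meets-sym p⋈A)) (ℕ.<⇒≱ p<A)
    ... | tri≈ _ p~A _ = contradiction (disjoint E p∈ A∈ p~A p⋈A) p≢A
    ... | tri> _ _ A<p = A<p
    above′ : ∀ {p g} → p ∈ P′ → g ∈ A ∷ G → Meetsᴮ p g → lev g < lev p
    above′ p∈ (here refl) = let (p∈P , p≢A) = ∈-remove⁻ A P p∈ in A<P p∈P p≢A
    above′ p∈ (there g∈)  = above E (proj₁ (∈-remove⁻ A P p∈)) g∈
    supported′ : ∀ {p} → p ∈ P′ → SupportedBy (A ∷ G) p ⊎ SupportedBy P′ p
    supported′ p∈ with supported E (proj₁ (∈-remove⁻ A P p∈))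
    ... | inj₁ (g , g∈ , p⋈g , e) = inj₁ (g , there g∈ , p⋈g , e)
    ... | inj₂ (q , q∈ , p⋈q , e) with q ≟ᴮ A
    ...   | yes refl = inj₁ (A , here refl , p⋈q , e)
    ...   | no  q≢A  = inj₂ (q , ∈-remove⁺ A P q∈ q≢A , p⋈q , e)
    rooted′ : ∀ {p} → p ∈ P′ → HasLowerIn P′ p ⊎ Within (grownStart lo) (grow N) (col p)
    rooted′ p∈ with rooted E (proj₁ (∈-remove⁻ A P p∈))
    ... | inj₂ p-within = inj₂ (within⇒within-grown p-within)
    ... | inj₁ (q , q∈ , p⋈q , q<p) with q ≟ᴮ A
    ...   | yes refl = inj₂ (meets⇒within-grown N p⋈q)
    ...   | no  q≢A  = inj₁ (q , ∈-remove⁺ A P q∈ q≢A , p⋈q , q<p)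

  covers-tail : ∀ {G lo N} → Covers G lo (suc N) → Covers G (ℤ.suc lo) N
  covers-tail covers c = covers c ∘ within-tail

  covers-grown : ∀ {G lo N} → Covers G lo (suc N) → Covers (restingBlock G lo ∷ G) (grownStart lo) (grow N)
  covers-grown {G} {lo} {N} covers c c-within with within-grown⁻ N c-within
  ... | inj₁ c⋈lo      = restingBlock G lo , here refl , c⋈lo
  ... | inj₂ c-within′ = let (g , g∈ , c⋈g) = covers c c-within′ in g , there g∈ , c⋈g

  extensions : ℕ → ℕ → List Block → ℤ → List (List Block)
  extensions zero    N       G lo = [] ∷ []
  extensions (suc m) zero    G lo = []
  extensions (suc m) (suc N) G lo =
    extensions (suc m) N G (ℤ.suc lo) ++
    map (insert (restingBlock G lo)) (extensions m (grow N) (restingBlock G lo ∷ G) (grownStart lo))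

  count : ℕ → ℕ → ℕ
  count zero    N       = 1
  count (suc m) zero    = 0
  count (suc m) (suc N) = count (suc m) N + count m (grow N)

  length-extensions : ∀ m N G lo → length (extensions m N G lo) ≡ count m N
  length-extensions zero    N       G lo = refl
  length-extensions (suc m) zero    G lo = refl
  length-extensions (suc m) (suc N) G lo = begin
    length (narrowed ++ map (insert A) grown)            ≡⟨ length-++ narrowed ⟩
    length narrowed + length (map (insert A) grown)      ≡⟨ cong (λ x → length narrowed + x) (length-map (insert A) grown) ⟩
    length narrowed + length grown                       ≡⟨ cong₂ _+_ (length-extensions (suc m) N G (ℤ.suc lo))
                                                                      (length-extensions m (grow N) (A ∷ G) (grownStart lo)) ⟩
    count (suc m) N + count m (grow N)                   ∎
    where
    open ≡-Reasoning
    A = restingBlock G lo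
    narrowed = extensions (suc m) N G (ℤ.suc lo)
    grown = extensions m (grow N) (A ∷ G) (grownStart lo)

  extensions-sound : ∀ m N G lo {P} → Covers G lo N → P ∈ extensions m N G lo →
                     Extension G lo N P × length P ≡ m
  extensions-sound zero    N       G lo covers (here refl) = []-extension , refl
  extensions-sound (suc m) (suc N) G lo {P} covers P∈ =
    [ Prod.map₁ extension-widen ∘ extensions-sound (suc m) N G (ℤ.suc lo) (covers-tail covers)
    , inserted ∘ ∈-map⁻ (insert A)
    ]′ (∈-++⁻ (extensions (suc m) N G (ℤ.suc lo)) P∈)
    where
    A = restingBlock G lo
    inserted : (∃ λ P′ → P′ ∈ extensions m (grow N) (A ∷ G) (grownStart lo) × P ≡ insert A P′) →
               Extension G lo (suc N) P × length P ≡ suc m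
    inserted (P′ , P′∈ , refl) =
      let E , len = extensions-sound m (grow N) (A ∷ G) (grownStart lo) (covers-grown covers) P′∈
      in extension-insert E covers , trans (length-insert A P′) (cong suc len)

  extensions-complete : ∀ m N G lo {P} → Extension G lo N P → length P ≡ m → P ∈ extensions m N G lo
  extensions-complete zero    N       G lo {[]} _ _ = here refl
  extensions-complete (suc m) zero    G lo E len with refl ← extension-zero E with () ← len
  extensions-complete (suc m) (suc N) G lo {P} E len =
    [ removed
    , ∈-++⁺ˡ ∘ (λ ¬pivotal → extensions-complete (suc m) N G (ℤ.suc lo) (extension-narrow E ¬pivotal) len)
    ]′ (Dec.toSum (pivotal? G lo P))
    where
    A = restingBlock G lo
    removed : Pivotal G lo P → P ∈ extensions (suc m) (suc N) G lo
    removed pivotal =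
      subst (_∈ extensions (suc m) (suc N) G lo) P≡
        (∈-++⁺ʳ (extensions (suc m) N G (ℤ.suc lo)) (∈-map⁺ (insert A)
          (extensions-complete m (grow N) (A ∷ G) (grownStart lo) (extension-remove E pivotal) len′)))
      where
      P≡ : insert A (remove A P) ≡ P
      P≡ = insert-remove (sorted E) (proj₁ pivotal)
      len′ : length (remove A P) ≡ m
      len′ = ℕ.suc-injective (trans (sym (length-insert A (remove A P))) (trans (cong length P≡) len))

  extensions-unique : ∀ m N G lo → Covers G lo N → Unique (extensions m N G lo)
  extensions-unique zero    N       G lo covers = [] ∷ []
  extensions-unique (suc m) zero    G lo covers = []
  extensions-unique (suc m) (suc N) G lo covers =
    Unique.++⁺ (extensions-unique (suc m) N G (ℤ.suc lo) (covers-tail covers))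
               (Unique-map⁺-∈ insert-injectiveOn
                 (extensions-unique m (grow N) (A ∷ G) (grownStart lo) (covers-grown covers)))
               pivotal-apart
    where
    A = restingBlock G lo
    grown = extensions m (grow N) (A ∷ G) (grownStart lo)
    sound-grown : ∀ {P} → P ∈ grown → Extension (A ∷ G) (grownStart lo) (grow N) P
    sound-grown = proj₁ ∘ extensions-sound m (grow N) (A ∷ G) (grownStart lo) (covers-grown covers)
    insert-injectiveOn : ∀ {P Q} → P ∈ grown → Q ∈ grown → insert A P ≡ insert A Q → P ≡ Q
    insert-injectiveOn P∈ Q∈ =
      insert-injective (ground∉extension (sound-grown P∈)) (ground∉extension (sound-grown Q∈))
                       (sorted (sound-grown P∈)) (sorted (sound-grown Q∈))
    pivotal-apart : Disjoint (extensions (suc m) N G (ℤ.suc lo)) (map (insert A) grown)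
    pivotal-apart (P∈ˡ , P∈ʳ) with ∈-map⁻ (insert A) P∈ʳ
    ... | P′ , P′∈ , refl =
      extension-tail-¬pivotal (proj₁ (extensions-sound (suc m) N G (ℤ.suc lo) (covers-tail covers) P∈ˡ))
                              (insert-pivotal (sound-grown P′∈))

-- Counting

[1+r]*[1+n]C[1+r]≡[1+n]*nCr : ∀ n r → suc r * (suc n C suc r) ≡ suc n * (n C r)
[1+r]*[1+n]C[1+r]≡[1+n]*nCr zero    zero    = refl
[1+r]*[1+n]C[1+r]≡[1+n]*nCr zero    (suc r) = begin
  suc (suc r) * (1 C suc (suc r)) ≡⟨ cong (suc (suc r) *_) (k>n⇒nCk≡0 {1} {suc (suc r)} (s≤s (s≤s z≤n))) ⟩
  suc (suc r) * 0                 ≡⟨ ℕ.*-zeroʳ (suc (suc r)) ⟩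
  0                               ≡⟨ cong (1 *_) (k>n⇒nCk≡0 {0} {suc r} (s≤s z≤n)) ⟨
  1 * (0 C suc r)                 ∎
  where open ≡-Reasoning
[1+r]*[1+n]C[1+r]≡[1+n]*nCr (suc n) zero    = begin
  1 * (suc (suc n) C 1) ≡⟨ ℕ.*-identityˡ _ ⟩
  suc (suc n) C 1       ≡⟨ nC1≡n (suc (suc n)) ⟩
  suc (suc n)           ≡⟨ ℕ.*-identityʳ (suc (suc n)) ⟨
  suc (suc n) * 1       ∎
  where open ≡-Reasoning
[1+r]*[1+n]C[1+r]≡[1+n]*nCr (suc n) (suc r) = begin
  suc (suc r) * (suc (suc n) C suc (suc r)) ≡⟨ cong (suc (suc r) *_) (pascal (suc n) (suc r)) ⟨
  suc (suc r) * (a + b)                     ≡⟨ distribute r a b ⟩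
  a + suc r * a + suc (suc r) * b           ≡⟨ cong₂ (λ x y → a + x + y) ([1+r]*[1+n]C[1+r]≡[1+n]*nCr n r)
                                                                        ([1+r]*[1+n]C[1+r]≡[1+n]*nCr n (suc r)) ⟩
  a + suc n * (n C r) + suc n * (n C suc r) ≡⟨ collect a n (n C r) (n C suc r) ⟩
  a + suc n * (n C r + n C suc r)           ≡⟨ cong (λ x → a + suc n * x) (pascal n r) ⟩
  a + suc n * a                             ≡⟨⟩
  suc (suc n) * a                           ∎
  where
  open ≡-Reasoning
  pascal = nCk+nC[k+1]≡[n+1]C[k+1]
  a = suc n C suc r
  b = suc n C suc (suc r)
  distribute : ∀ r a b → suc (suc r) * (a + b) ≡ a + suc r * a + suc (suc r) * b
  distribute = ℕ.solve-∀
  collect : ∀ a n c d → a + suc n * c + suc n * d ≡ a + suc n * (c + d)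
  collect = ℕ.solve-∀

module Counting (k₀ : ℕ) where

  open Columns k₀
  open Extensions k₀ using (count)
  open ≡-Reasoning

  count-short : ∀ m N → N ≤ k → count (suc m) N ≡ N * count m (k + k₀)
  count-short m zero    _         = refl
  count-short m (suc N) (s≤s N<k) = begin
    count (suc m) N + count m (grow N)      ≡⟨ cong₂ _+_ (count-short m N (ℕ.m≤n⇒m≤1+n N<k))
                                                         (cong (count m) grow-short) ⟩
    N * count m (k + k₀) + count m (k + k₀) ≡⟨ ℕ.+-comm (N * count m (k + k₀)) _ ⟩
    suc N * count m (k + k₀)                ∎
    where
    grow-short : grow N ≡ k + k₀
    grow-short = ℕ.m≤n⇒m⊔n≡n (subst (_≤ k + k₀) (ℕ.+-comm k N) (ℕ.+-monoʳ-≤ k N<k))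

  count-closed : ∀ m j → count m (k + j) ≡ (j + k * m) C m
  count-closed zero    j       = refl
  count-closed (suc m) zero    = begin
    count (suc m) (k + 0)     ≡⟨ cong (count (suc m)) (ℕ.+-identityʳ k) ⟩
    count (suc m) k           ≡⟨ count-short m k ℕ.≤-refl ⟩
    k * count m (k + k₀)      ≡⟨ cong (k *_) (count-closed m k₀) ⟩
    k * (n C m)               ≡⟨ ℕ.*-cancelˡ-≡ _ _ (suc m) absorbed ⟩
    (k * suc m) C suc m       ∎
    where
    n = k₀ + k * m
    k[1+m]≡1+n : k * suc m ≡ suc n
    k[1+m]≡1+n = ℕ.*-suc k m
    absorbed : suc m * (k * (n C m)) ≡ suc m * ((k * suc m) C suc m)
    absorbed = begin
      suc m * (k * (n C m))               ≡⟨ ℕ.*-assoc (suc m) k (n C m) ⟨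
      suc m * k * (n C m)                 ≡⟨ cong (_* (n C m)) (trans (ℕ.*-comm (suc m) k) k[1+m]≡1+n) ⟩
      suc n * (n C m)                     ≡⟨ [1+r]*[1+n]C[1+r]≡[1+n]*nCr n m ⟨
      suc m * (suc n C suc m)             ≡⟨ cong (λ x → suc m * (x C suc m)) k[1+m]≡1+n ⟨
      suc m * ((k * suc m) C suc m)       ∎
  count-closed (suc m) (suc j) = begin
    count (suc m) (k + suc j)                          ≡⟨ cong (count (suc m)) (ℕ.+-suc k j) ⟩
    count (suc m) (k + j) + count m (grow (k + j))     ≡⟨ cong₂ _+_ (count-closed (suc m) j)
                                                                    (cong (count m) grow-long) ⟩
    n C suc m + count m (k + (j + k))                  ≡⟨ cong (λ x → n C suc m + x) (count-closed m (j + k)) ⟩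
    n C suc m + (j + k + k * m) C m                    ≡⟨ cong (λ x → n C suc m + x C m) (regroup j k m) ⟩
    n C suc m + n C m                                  ≡⟨ ℕ.+-comm (n C suc m) (n C m) ⟩
    n C m + n C suc m                                  ≡⟨ nCk+nC[k+1]≡[n+1]C[k+1] n m ⟩
    suc n C suc m                                      ∎
    where
    n = j + k * suc m
    grow-long : grow (k + j) ≡ k + (j + k)
    grow-long = trans (ℕ.m≥n⇒m⊔n≡m k+k₀≤) (ℕ.+-assoc k j k)
      where
      k+k₀≤ : k + k₀ ≤ k + j + k
      k+k₀≤ = subst (k + k₀ ≤_) (sym (ℕ.+-assoc k j k))
                (ℕ.+-monoʳ-≤ k (ℕ.≤-trans (ℕ.n≤1+n k₀) (ℕ.m≤n+m k j)))
    regroup : ∀ j k m → j + k + k * m ≡ j + k * suc m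
    regroup = ℕ.solve-∀

-- Towers

length-baseRow : ∀ k b → length (baseRow k b) ≡ b
length-baseRow k b = trans (length-map _ (upTo b)) (length-upTo b)

tower⇒base≤size : ∀ {k n b l} → IsTower k n b l → b ≤ n
tower⇒base≤size {k} {n} {b} T with IsTower.base T
... | rest , refl , _ = subst (b ≤_) (IsTower.size T) (begin
  b                                  ≤⟨ ℕ.m≤m+n b (length rest) ⟩
  b + length rest                    ≡⟨ cong (_+ length rest) (length-baseRow k b) ⟨
  length (baseRow k b) + length rest ≡⟨ length-++ (baseRow k b) ⟨
  length (baseRow k b ++ rest)       ∎)
  where open ℕ.≤-Reasoning

no-towers : ∀ {k n b} → n < b → NumberOfTowers k n b 0
no-towers n<b = [] , [] , (λ l → mk⇔ (λ ()) (λ T → contradiction (tower⇒base≤size T) (ℕ.<⇒≱ n<b))) , refl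

module BaseRow (k₀ b₀ : ℕ) where

  open Columns k₀
  open Extensions k₀
  open Extension
  open Equivalence using (to; from)

  b : ℕ
  b = suc b₀

  base : List Block
  base = baseRow k b

  baseBlock : ℕ → Block
  baseBlock i = + (i * k) , 0

  ∈-base⁻ : ∀ {g} → g ∈ base → ∃ λ i → i < b × g ≡ baseBlock i
  ∈-base⁻ g∈ = let (i , i∈ , g≡) = ∈-map⁻ baseBlock g∈ in i , ∈-upTo⁻ i∈ , g≡

  ∈-base⁺ : ∀ {i} → i < b → baseBlock i ∈ base
  ∈-base⁺ = ∈-map⁺ baseBlock ∘ ∈-upTo⁺

  lev-base : ∀ {g} → g ∈ base → lev g ≡ 0
  lev-base g∈ with ∈-base⁻ g∈
  ... | _ , _ , refl = refl

  -- The columns meeting the base row [0, b k) form the window [-k₀, b k).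
  baseStart : ℤ
  baseStart = ℤ.- + k₀

  baseWidth : ℕ
  baseWidth = k + (k₀ + b₀ * k)

  baseEnd : baseStart ℤ.+ + baseWidth ≡ + (b₀ * k + k)
  baseEnd = shift (+ k₀) (+ (b₀ * k)) (+ k)
    where
    shift : ∀ a x y → ℤ.- a ℤ.+ (y ℤ.+ (a ℤ.+ x)) ≡ x ℤ.+ y
    shift = ℤ.solve-∀

  meets-base⇒within : ∀ {c i} → i < b → Meets c (+ (i * k)) → Within baseStart baseWidth c
  meets-base⇒within {c} {i} (s≤s i≤b₀) (c<ik+k , ik<c+k) =
    ℤ.≤-trans start≤ (meets-lowerBound ik<c+k) , ℤ.<-≤-trans c<ik+k (subst (+ (i * k + k) ℤ.≤_) (sym baseEnd) end≤)
    where
    start≤ : baseStart ℤ.≤ + (i * k) - + k₀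
    start≤ = subst (ℤ._≤ + (i * k) - + k₀) (ℤ.+-identityˡ baseStart) (ℤ.+-monoˡ-≤ baseStart (ℤ.+≤+ z≤n))
    end≤ : + (i * k + k) ℤ.≤ + (b₀ * k + k)
    end≤ = ℤ.+≤+ (ℕ.+-monoˡ-≤ k (ℕ.*-monoˡ-≤ k i≤b₀))

  base-covers : Covers base baseStart baseWidth
  base-covers ℤ.-[1+ n ] (start≤c , _) = baseBlock 0 , ∈-base⁺ (s≤s z≤n) , ℤ.-<+ , 0<c+k
    where
    0<c+k : + 0 ℤ.< ℤ.-[1+ n ] ℤ.+ + k
    0<c+k = subst (ℤ._< ℤ.-[1+ n ] ℤ.+ + k) (ℤ.+-inverseˡ (+ k₀))
              (ℤ.≤-<-trans (ℤ.+-monoˡ-≤ (+ k₀) start≤c) (ℤ.+-monoʳ-< ℤ.-[1+ n ] (ℤ.+<+ (ℕ.n<1+n k₀))))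
  base-covers (+ n) (_ , c<end) = baseBlock i , ∈-base⁺ i<b , ℤ.+<+ n<ik+k , ℤ.+<+ ik<n+k
    where
    i = n / k
    n≡ : n ≡ n % k + i * k
    n≡ = m≡m%n+[m/n]*n n k
    i<b : i < b
    i<b = m<n*o⇒m/o<n (subst (n <_) (ℕ.+-comm (b₀ * k) k) (ℤ.drop‿+<+ (subst (+ n ℤ.<_) baseEnd c<end)))
    n<ik+k : n < i * k + k
    n<ik+k = subst (_< i * k + k) (sym n≡)
               (subst (n % k + i * k <_) (ℕ.+-comm k (i * k)) (ℕ.+-monoˡ-< (i * k) (m%n<n n k)))
    ik<n+k : i * k < n + k
    ik<n+k = ℕ.≤-<-trans (subst (i * k ≤_) (sym n≡) (ℕ.m≤n+m (i * k) (n % k))) (ℕ.m<m+n n (s≤s z≤n))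

  base-sorted : Sorted base
  base-sorted = Linked.Linked⇒AllPairs <ᴮ-trans (Linked.map⁺ (Linked.applyUpTo⁺₂ (λ i → i) b step))
    where
    step : ∀ i → baseBlock i <ᴮ baseBlock (suc i)
    step i = inj₂ (refl , ℤ.+<+ (ℕ.m<n+m (i * k) (s≤s z≤n)))

  base-nonOverlapping : AllPairs (NonOverlapping k) base
  base-nonOverlapping = AllPairs.map⁺ (AllPairs.map apart
    (Linked.Linked⇒AllPairs ℕ.<-trans (Linked.applyUpTo⁺₂ (λ i → i) b ℕ.n<1+n)))
    where
    apart : ∀ {i j} → i < j → NonOverlapping k (baseBlock i) (baseBlock j)
    apart {i} {j} i<j = inj₂ (ℕ.≮⇒≥ λ close →
      ℕ.<⇒≱ (ℤ.drop‿+<+ (proj₂ (to (columnsMeet⇔meets {+ (i * k)}) close)))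
            (subst (_≤ j * k) (ℕ.+-comm k (i * k)) (ℕ.*-monoˡ-≤ k i<j)))

  lifted : ∀ {P p} → Extension base baseStart baseWidth P → p ∈ P → 1 ≤ lev p
  lifted E p∈ with supported E p∈
  ... | inj₁ (_ , _ , _ , e) = subst (1 ≤_) e (s≤s z≤n)
  ... | inj₂ (_ , _ , _ , e) = subst (1 ≤_) e (s≤s z≤n)

  extension⇒tower : ∀ {n P} → Extension base baseStart baseWidth P → length (base ++ P) ≡ n →
                    IsTower k n b (base ++ P)
  extension⇒tower {P = P} E len = record
    { sorted     = Linked.AllPairs⇒Linked
                     (AllPairs.++⁺ base-sorted (sorted E) (base-below λ g~0 p∈ → inj₁ (lifted′ g~0 p∈)))
    ; size       = len
    ; nonOverlap = AllPairs.++⁺ base-nonOverlapping P-nonOverlapping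
                     (base-below λ g~0 p∈ → inj₁ (λ g~p → ℕ.<-irrefl g~p (lifted′ g~0 p∈)))
    ; base       = P , refl , All.tabulate (lifted E)
    ; supported  = All.++⁺ (All.tabulate (inj₁ ∘ lev-base)) (All.tabulate P-supported)
    }
    where
    lifted′ : ∀ {y p} → y ≡ 0 → p ∈ P → y < lev p
    lifted′ refl = lifted E
    base-below : ∀ {R : Block → Block → Set} → (∀ {g p} → lev g ≡ 0 → p ∈ P → R g p) →
                 All (λ g → All (R g) P) base
    base-below R-below = All.tabulate λ g∈ → All.tabulate (R-below (lev-base g∈))
    P-nonOverlapping : AllPairs (NonOverlapping k) P
    P-nonOverlapping = AllPairs-map-∈ apart (sorted E)
      where
      apart : ∀ {p q} → p ∈ P → q ∈ P → p <ᴮ q → NonOverlapping k p q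
      apart {p} {q} p∈ q∈ p<q with lev p ℕ.≟ lev q
      ... | no  p≁q = inj₁ p≁q
      ... | yes p~q = inj₂ (ℕ.≮⇒≥ λ close → <ᴮ-irrefl (disjoint E p∈ q∈ p~q (to columnsMeet⇔meets close)) p<q)
    P-supported : ∀ {p} → p ∈ P → lev p ≡ 0 ⊎ Supported k (base ++ P) p
    P-supported p∈ with supported E p∈
    ... | inj₁ (g , g∈ , p⋈g , e) = inj₂ (g , ∈-++⁺ˡ g∈ , e , from columnsMeet⇔meets p⋈g)
    ... | inj₂ (q , q∈ , p⋈q , e) = inj₂ (q , ∈-++⁺ʳ base q∈ , e , from columnsMeet⇔meets p⋈q)

  tower⇒extension : ∀ {n l} → IsTower k n b l →
                    ∃ λ P → l ≡ base ++ P × Extension base baseStart baseWidth P × length P ≡ n ∸ b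
  tower⇒extension {n} T with IsTower.base T
  ... | P , refl , P-lifted = P , refl , E , length-rest
    where
    P-nonOverlapping : AllPairs (NonOverlapping k) P
    P-nonOverlapping = AllPairs-++⁻ʳ base (IsTower.nonOverlap T)
    disjoint′ : ∀ {p q} → p ∈ P → q ∈ P → lev p ≡ lev q → Meetsᴮ p q → p ≡ q
    disjoint′ {p} {q} p∈ q∈ p~q p⋈q with p ≟ᴮ q
    ... | yes p≡q = p≡q
    ... | no  p≢q with AllPairs-lookup P-nonOverlapping p∈ q∈ p≢q
    ...   | inj₁ (inj₁ p≁q) = contradiction p~q p≁q
    ...   | inj₁ (inj₂ far) = contradiction (from columnsMeet⇔meets p⋈q) (ℕ.≤⇒≯ far)
    ...   | inj₂ (inj₁ q≁p) = contradiction (sym p~q) q≁p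
    ...   | inj₂ (inj₂ far) = contradiction (from columnsMeet⇔meets (meets-sym p⋈q)) (ℕ.≤⇒≯ far)
    supported′ : ∀ {p} → p ∈ P → SupportedBy base p ⊎ SupportedBy P p
    supported′ {p} p∈ with All.lookup (IsTower.supported T) (∈-++⁺ʳ base p∈)
    ... | inj₁ p~0 = contradiction (All.lookup P-lifted p∈) (ℕ.<-irrefl (sym p~0))
    ... | inj₂ (q , q∈ , e , close) =
      Sum.map (λ q∈′ → q , q∈′ , to columnsMeet⇔meets close , e)
              (λ q∈′ → q , q∈′ , to columnsMeet⇔meets close , e) (∈-++⁻ base q∈)
    rooted′ : ∀ {p} → p ∈ P → HasLowerIn P p ⊎ Within baseStart baseWidth (col p)
    rooted′ p∈ with supported′ p∈
    ... | inj₂ (q , q∈ , p⋈q , e) = inj₁ (q , q∈ , p⋈q , ℕ.≤-reflexive e)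
    ... | inj₁ (g , g∈ , p⋈g , _) with ∈-base⁻ g∈
    ...   | i , i<b , refl = inj₂ (meets-base⇒within i<b p⋈g)
    E : Extension base baseStart baseWidth P
    E = record
      { sorted    = AllPairs-++⁻ʳ base (Linked.Linked⇒AllPairs <ᴮ-trans (IsTower.sorted T))
      ; disjoint  = disjoint′
      ; above     = λ p∈ g∈ _ → subst (_< _) (sym (lev-base g∈)) (All.lookup P-lifted p∈)
      ; supported = supported′
      ; rooted    = rooted′
      }
    length-rest : length P ≡ n ∸ b
    length-rest = begin
      length P                   ≡⟨ ℕ.m+n∸m≡n b (length P) ⟨
      b + length P ∸ b           ≡⟨ cong (λ x → x + length P ∸ b) (length-baseRow k b) ⟨
      length base + length P ∸ b ≡⟨ cong (_∸ b) (length-++ base) ⟨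
      length (base ++ P) ∸ b     ≡⟨ cong (_∸ b) (IsTower.size T) ⟩
      n ∸ b                      ∎
      where open ≡-Reasoning

  towers : ∀ n → b ≤ n → NumberOfTowers k n b (count (n ∸ b) baseWidth)
  towers n b≤n = map (base ++_) exts , unique , (λ l → mk⇔ (sound l) complete) , length-towers
    where
    exts = extensions (n ∸ b) baseWidth base baseStart
    unique : Unique (map (base ++_) exts)
    unique = Unique.map⁺ (++-cancelˡ base _ _) (extensions-unique (n ∸ b) baseWidth base baseStart base-covers)
    sound : ∀ l → l ∈ map (base ++_) exts → IsTower k n b l
    sound l l∈ with ∈-map⁻ (base ++_) l∈
    ... | P , P∈ , refl with extensions-sound (n ∸ b) baseWidth base baseStart base-covers P∈
    ...   | E , len = extension⇒tower E (begin
      length (base ++ P)       ≡⟨ length-++ base ⟩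
      length base + length P   ≡⟨ cong₂ _+_ (length-baseRow k b) len ⟩
      b + (n ∸ b)              ≡⟨ ℕ.m+[n∸m]≡n b≤n ⟩
      n                        ∎)
      where open ≡-Reasoning
    complete : ∀ {l} → IsTower k n b l → l ∈ map (base ++_) exts
    complete T with tower⇒extension T
    ... | P , refl , E , len = ∈-map⁺ (base ++_) (extensions-complete (n ∸ b) baseWidth base baseStart E len)
    length-towers : length (map (base ++_) exts) ≡ count (n ∸ b) baseWidth
    length-towers = trans (length-map (base ++_) exts) (length-extensions (n ∸ b) baseWidth base baseStart)

  count-base : ∀ n → b ≤ n → count (n ∸ b) baseWidth ≡ (k * n ∸ 1) C (n ∸ b)
  count-base n b≤n = begin
    count (n ∸ b) (k + (k₀ + b₀ * k))        ≡⟨ Counting.count-closed k₀ (n ∸ b) (k₀ + b₀ * k) ⟩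
    (k₀ + b₀ * k + k * (n ∸ b)) C (n ∸ b)   ≡⟨ cong (λ x → ℕ.pred x C (n ∸ b)) 1+top≡kn ⟩
    (k * n ∸ 1) C (n ∸ b)                    ∎
    where
    open ≡-Reasoning
    expand : ∀ k₀ b₀ m → suc (k₀ + b₀ * suc k₀ + suc k₀ * m) ≡ suc k₀ * (suc b₀ + m)
    expand = ℕ.solve-∀
    1+top≡kn : suc (k₀ + b₀ * k + k * (n ∸ b)) ≡ k * n
    1+top≡kn = trans (expand k₀ b₀ (n ∸ b)) (cong (k *_) (ℕ.m+[n∸m]≡n b≤n))

binomℤ-≥ : ∀ m {n b} → b ≤ n → binomℤ m (+ n - + b) ≡ m C (n ∸ b)
binomℤ-≥ m {n} {b} b≤n = cong (binomℤ m) (trans (ℤ.m-n≡m⊖n n b) (ℤ.⊖-≥ b≤n))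

binomℤ-< : ∀ m {n b} → n < b → binomℤ m (+ n - + b) ≡ 0
binomℤ-< m {n} {b} n<b rewrite ℤ.m-n≡m⊖n n b | ℤ.⊖-< n<b | ℕ.+-∸-assoc 1 n<b = refl

theorem3p2 : (k n b : ℕ) → 1 ≤ k → 1 ≤ n → 1 ≤ b →
    NumberOfTowers k n b (binomℤ (k * n ∸ 1) (+ n - + b))
theorem3p2 (suc k₀) n (suc b₀) (s≤s z≤n) _ (s≤s z≤n) with suc b₀ ℕ.≤? n
... | yes b≤n = subst (NumberOfTowers (suc k₀) n (suc b₀))
                      (trans (count-base n b≤n) (sym (binomℤ-≥ (suc k₀ * n ∸ 1) b≤n)))
                      (towers n b≤n)
  where open BaseRow k₀ b₀
... | no  b≰n = subst (NumberOfTowers (suc k₀) n (suc b₀))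
                      (sym (binomℤ-< (suc k₀ * n ∸ 1) (ℕ.≰⇒> b≰n)))
                      (no-towers (ℕ.≰⇒> b≰n))
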